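{- Let $a,c\ge 1$ be integers with $a\ne c$. Then $U=\{(a,0),(c,0)\}$ is unavoidable in $\mathcal{B}$.
   Context: The bicyclic inverse semigroup is $\mathcal{B}=\{(a,b)\in\mathbb{Z}\times\mathbb{Z}\mid a\ge 0,\ a+b\ge 0\}$ with multiplication $(a,b)(c,d)=(\max\{c+d,a\}-d,\ b+d)$. A subset $U\subseteq\mathcal{B}$ is avoidable if $\mathcal{B}$ can be partitioned into two sets $A$ and $B$ such that no element of $U$ is a product $st$ of two distinct elements $s\ne t$ both in $A$ or both in $B$; otherwise $U$ is unavoidable. -}

module Defs where

open import Data.Integer using (ℤ; +_; _+_; _-_; _≤_; _⊔_)
open import Data.Bool using (Bool)
open import Data.Product using (Σ; ∃; _×_; _,_)
open import Relation.Binary.PropositionalEquality using (_≡_)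
open import Relation.Nullary using (¬_)

-- The bicyclic inverse semigroup: pairs (a,b) ∈ ℤ×ℤ with a ≥ 0 and a + b ≥ 0.
record 𝓑 : Set where
  constructor mk𝓑
  field
    fst : ℤ
    snd : ℤ
    fst≥0 : + 0 ≤ fst
    sum≥0 : + 0 ≤ fst + snd
open 𝓑 public

_≈𝓑_ : 𝓑 → 𝓑 → Set
s ≈𝓑 t = (fst s ≡ fst t) × (snd s ≡ snd t)

-- Underlying pair of the product (a,b)(c,d) = (max{c+d,a} - d, b + d).
-- (Membership of the result in 𝓑 is not needed for the statement, so we
-- work with the underlying integer pair.)
prodFst : 𝓑 → 𝓑 → ℤ
prodFst s t = ((fst t + snd t) ⊔ fst s) - snd t

prodSnd : 𝓑 → 𝓑 → ℤ
prodSnd s t = snd s + snd t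

ProdIs : 𝓑 → 𝓑 → ℤ → ℤ → Set
ProdIs s t x y = (prodFst s t ≡ x) × (prodSnd s t ≡ y)

Subset𝓑 : Set₁
Subset𝓑 = ℤ → ℤ → Set

-- U is avoidable: there is a partition of 𝓑 into two classes A, B
-- (given by a colouring χ : 𝓑 → Bool) such that no element of U is a
-- product st of distinct s ≠ t in the same class.
Avoidable : Subset𝓑 → Set
Avoidable U = Σ (𝓑 → Bool) λ χ →
  ∀ (s t : 𝓑) → ¬ (s ≈𝓑 t) → χ s ≡ χ t →
    ¬ (U (prodFst s t) (prodSnd s t))

Unavoidable : Subset𝓑 → Set
Unavoidable U = ¬ Avoidable U

Pair0 : ℤ → ℤ → Subset𝓑
Pair0 a c x y = ((x ≡ a) × (y ≡ + 0)) ⊎' ((x ≡ c) × (y ≡ + 0))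
  where
  open import Data.Sum using () renaming (_⊎_ to _⊎'_)

module Submission where

open import Defs
open import Data.Nat using (ℕ; _≥_)
open import Data.Integer using (+_)
open import Relation.Binary.PropositionalEquality using (_≢_)

open import Data.Nat as ℕ using (z≤n; _⊔_)
open import Data.Nat.Properties using (+-identityʳ; ⊔-comm; ⊔-sel; <⇒≢)
open import Data.Integer using (+≤+)
open import Data.Integer.Properties using (+-injective)
open import Data.Bool using (Bool; true; false)
open import Data.Product using (_×_; _,_)
open import Data.Sum using (_⊎_; inj₁; inj₂)
open import Relation.Binary.PropositionalEquality
  using (_≡_; refl; sym; cong; subst; module ≡-Reasoning)
open import Relation.Nullary using (¬_)

-- The idempotents of 𝓑 are the elements (n,0), and they
-- multiply by taking the maximum: (m,0)(n,0) = (max{m,n},0).  Hence for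
-- 0 < a ≠ c the three distinct idempotents (0,0), (a,0), (c,0) are
-- pairwise "forbidden": the product of any two of them is (a,0) or
-- (c,0), i.e. lies in U.  In any 2-colouring of 𝓑 two of these three
-- elements receive the same colour (pigeonhole), so no colouring avoids U.

-- An edge for U: two distinct elements whose product lies in U.  Any
-- colouring avoiding U must give the endpoints of an edge different colours.
Edge : Subset𝓑 → 𝓑 → 𝓑 → Set
Edge U s t = ¬ (s ≈𝓑 t) × U (prodFst s t) (prodSnd s t)

twoOfThreeAgree : (x y z : Bool) → (x ≡ y) ⊎ (y ≡ z) ⊎ (x ≡ z)
twoOfThreeAgree false false _     = inj₁ refl
twoOfThreeAgree true  true  _     = inj₁ refl
twoOfThreeAgree false true  true  = inj₂ (inj₁ refl)
twoOfThreeAgree true  false false = inj₂ (inj₁ refl)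
twoOfThreeAgree false true  false = inj₂ (inj₂ refl)
twoOfThreeAgree true  false true  = inj₂ (inj₂ refl)

-- A triangle of edges is not 2-colourable, so it makes U unavoidable.
triangle⇒unavoidable : (U : Subset𝓑) (r s t : 𝓑) →
  Edge U r s → Edge U s t → Edge U r t → Unavoidable U
triangle⇒unavoidable U r s t (r≉s , rs∈U) (s≉t , st∈U) (r≉t , rt∈U) (χ , avoids)
  with twoOfThreeAgree (χ r) (χ s) (χ t)
... | inj₁ χr≡χs        = avoids r s r≉s χr≡χs rs∈U
... | inj₂ (inj₁ χs≡χt) = avoids s t s≉t χs≡χt st∈U
... | inj₂ (inj₂ χr≡χt) = avoids r t r≉t χr≡χt rt∈U

idem : ℕ → 𝓑
idem n = mk𝓑 (+ n) (+ 0) (+≤+ z≤n) (+≤+ z≤n)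

idem-prodFst : (m n : ℕ) → prodFst (idem m) (idem n) ≡ + (m ⊔ n)
idem-prodFst m n = begin
  + ((n ℕ.+ 0 ⊔ m) ℕ.+ 0) ≡⟨ cong +_ (+-identityʳ (n ℕ.+ 0 ⊔ m)) ⟩
  + (n ℕ.+ 0 ⊔ m)         ≡⟨ cong (λ k → + (k ⊔ m)) (+-identityʳ n) ⟩
  + (n ⊔ m)               ≡⟨ cong +_ (⊔-comm n m) ⟩
  + (m ⊔ n)               ∎
  where open ≡-Reasoning

idem-distinct : {m n : ℕ} → m ≢ n → ¬ (idem m ≈𝓑 idem n)
idem-distinct m≢n (fst≡ , _) = m≢n (+-injective fst≡)

idemEdge : (U : Subset𝓑) {m n : ℕ} → m ≢ n → U (+ (m ⊔ n)) (+ 0) →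
  Edge U (idem m) (idem n)
idemEdge U {m} {n} m≢n max∈U =
  idem-distinct m≢n , subst (λ x → U x (+ 0)) (sym (idem-prodFst m n)) max∈U

max∈Pair0 : (a c : ℕ) → Pair0 (+ a) (+ c) (+ (a ⊔ c)) (+ 0)
max∈Pair0 a c with ⊔-sel a c
... | inj₁ a⊔c≡a = inj₁ (cong +_ a⊔c≡a , refl)
... | inj₂ a⊔c≡c = inj₂ (cong +_ a⊔c≡c , refl)

mainTheorem13 : (a c : ℕ) → a ≥ 1 → c ≥ 1 → a ≢ c →
    Unavoidable (Pair0 (+ a) (+ c))
mainTheorem13 a c a≥1 c≥1 a≢c =
  triangle⇒unavoidable U (idem 0) (idem a) (idem c)
    (idemEdge U (<⇒≢ a≥1) (inj₁ (refl , refl)))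
    (idemEdge U a≢c (max∈Pair0 a c))
    (idemEdge U (<⇒≢ c≥1) (inj₂ (refl , refl)))
  where
  U : Subset𝓑
  U = Pair0 (+ a) (+ c)
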